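{- Let $(a,b,c,d,e,f)$ be any one of the following fifteen 6-tuples: $(1,-1,1,-1,-2,1)$, $(1,-1,1,-2,-1,1)$, $(1,1,-1,-2,1,1)$, $(1,1,2,-2,3,1)$, $(1,-1,3,2,-2,1)$, $(1,-1,3,-2,2,1)$, $(2,-1,-1,1,-6,1)$, $(2,-1,-1,-6,1,1)$, $(1,1,1,-6,-1,2)$, $(2,1,2,-2,5,1)$, $(1,-1,5,-2,2,2)$, $(1,-2,5,2,-2,1)$, $(1,-1,7,-7,2,4)$, $(1,-4,7,2,-7,1)$, $(1,4,-7,2,7,1)$. Then for every positive integer $n$ and all integers $m$ and $p$, \[ \sum_{j = 0}^{\lfloor n/2 \rfloor} ( - 1)^j \frac{n}{n - j}\binom{n-j}{j}a^j b^j f^{n - 2j} P_{(m + e)n + p + (c - 2e + d)j} = a^n P_{(m + c)n + p} + b^n P_{(m + d)n + p} \] and \[ \sum_{j = 0}^{\lfloor n/2 \rfloor} ( - 1)^j \frac{n}{n - j}\binom{n-j}{j}a^j b^j f^{n - 2j} Q_{(m + e)n + p + (c - 2e + d)j} = a^n Q_{(m + c)n + p} + b^n Q_{(m + d)n + p}. \]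
   Context: The Padovan numbers $P_n$ are defined for all integers $n$ by $P_0=P_1=P_2=1$ and $P_n=P_{n-2}+P_{n-3}$ for all integers $n$ (extended to negative indices via $P_n=P_{n+3}-P_{n+1}$). The Perrin numbers $Q_n$ are defined for all integers $n$ by $Q_0=3$, $Q_1=0$, $Q_2=2$ and $Q_n=Q_{n-2}+Q_{n-3}$ for all integers $n$. -}

module Defs where

open import Data.Nat as ℕ using (ℕ; zero; suc)
open import Data.Nat.Combinatorics using (_C_)
open import Data.Integer as ℤ using (ℤ; +_; -[1+_]; _+_; _-_; _*_; _^_; -_)
open import Data.Product using (_×_; _,_; proj₁)
open import Data.List using (List; []; _∷_; map; upTo; foldr)
import Data.Integer.Properties

-- Triples of consecutive values (x_k, x_{k+1}, x_{k+2}) of a sequence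
-- satisfying x_{k+3} = x_{k+1} + x_k.
Triple : Set
Triple = ℤ × ℤ × ℤ

fwd : Triple → Triple
fwd (x0 , x1 , x2) = (x1 , x2 , x0 + x1)

-- backward step: (x_k,x_{k+1},x_{k+2}) ↦ (x_{k-1},x_k,x_{k+1}),
-- using x_{k-1} = x_{k+2} - x_k
bwd : Triple → Triple
bwd (x0 , x1 , x2) = (x2 - x0 , x0 , x1)

iter : (Triple → Triple) → ℕ → Triple → Triple
iter f zero t = t
iter f (suc k) t = f (iter f k t)

seqAt : Triple → ℤ → ℤ
seqAt t (+ n) = proj₁ (iter fwd n t)
seqAt t -[1+ k ] = proj₁ (iter bwd (suc k) t)

P : ℤ → ℤ
P = seqAt (+ 1 , + 1 , + 1)

Q : ℤ → ℤ
Q = seqAt (+ 3 , + 0 , + 2)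

-- The coefficient (n / (n - j)) * binom(n - j, j) (an integer for n ≥ 1, j ≤ n/2),
-- computed as the exact natural division (n * binom(n-j, j)) / (n - j).
-- The case n - j = 0 never occurs in the range used (n ≥ 1, j ≤ ⌊n/2⌋).
coeff : ℕ → ℕ → ℕ
coeff n j with n ℕ.∸ j
... | zero = 0
... | suc k = (n ℕ.* ((n ℕ.∸ j) C j)) ℕ./ suc k

sgn : ℕ → ℤ
sgn zero = + 1
sgn (suc j) = - sgn j

sumHalf : ℕ → (ℕ → ℤ) → ℤ
sumHalf n g = foldr _+_ (+ 0) (map g (upTo (suc (n ℕ./ 2))))

Tuple6 : Set
Tuple6 = ℤ × ℤ × ℤ × ℤ × ℤ × ℤ

tuples : List Tuple6
tuples =
    (+ 1 , - + 1 , + 1 , - + 1 , - + 2 , + 1)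
  ∷ (+ 1 , - + 1 , + 1 , - + 2 , - + 1 , + 1)
  ∷ (+ 1 , + 1 , - + 1 , - + 2 , + 1 , + 1)
  ∷ (+ 1 , + 1 , + 2 , - + 2 , + 3 , + 1)
  ∷ (+ 1 , - + 1 , + 3 , + 2 , - + 2 , + 1)
  ∷ (+ 1 , - + 1 , + 3 , - + 2 , + 2 , + 1)
  ∷ (+ 2 , - + 1 , - + 1 , + 1 , - + 6 , + 1)
  ∷ (+ 2 , - + 1 , - + 1 , - + 6 , + 1 , + 1)
  ∷ (+ 1 , + 1 , + 1 , - + 6 , - + 1 , + 2)
  ∷ (+ 2 , + 1 , + 2 , - + 2 , + 5 , + 1)
  ∷ (+ 1 , - + 1 , + 5 , - + 2 , + 2 , + 2)
  ∷ (+ 1 , - + 2 , + 5 , + 2 , - + 2 , + 1)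
  ∷ (+ 1 , - + 1 , + 7 , - + 7 , + 2 , + 4)
  ∷ (+ 1 , - + 4 , + 7 , + 2 , - + 7 , + 1)
  ∷ (+ 1 , + 4 , - + 7 , + 2 , + 7 , + 1)
  ∷ []

lhs : (ℤ → ℤ) → Tuple6 → ℕ → ℤ → ℤ → ℤ
lhs R (a , b , c , d , e , f) n m p =
  sumHalf n (λ j → sgn j * (+ coeff n j) * (a ^ j) * (b ^ j) * (f ^ (n ℕ.∸ (2 ℕ.* j)))
                   * R ((m + e) * + n + p + (c - + 2 * e + d) * + j))

rhs : (ℤ → ℤ) → Tuple6 → ℕ → ℤ → ℤ → ℤ
rhs R (a , b , c , d , e , f) n m p =
  (a ^ n) * R ((m + c) * + n + p) + (b ^ n) * R ((m + d) * + n + p)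

open import Relation.Binary.PropositionalEquality using (_≡_; refl)
_ : map P (-[1+ 4 ] ∷ -[1+ 3 ] ∷ -[1+ 2 ] ∷ -[1+ 1 ] ∷ -[1+ 0 ] ∷ + 3 ∷ + 4 ∷ + 5 ∷ + 6 ∷ []) ≡ (+ 1 ∷ + 0 ∷ + 0 ∷ + 1 ∷ + 0 ∷ + 2 ∷ + 2 ∷ + 3 ∷ + 4 ∷ [])
_ = refl
_ : map Q (-[1+ 0 ] ∷ -[1+ 1 ] ∷ + 3 ∷ + 5 ∷ []) ≡ (- + 1 ∷ + 1 ∷ + 3 ∷ + 5 ∷ [])
_ = refl
_ : map (coeff 6) (0 ∷ 1 ∷ 2 ∷ 3 ∷ []) ≡ (1 ∷ 6 ∷ 9 ∷ 2 ∷ [])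
_ = refl
_ : lhs P (+ 1 , - + 1 , + 1 , - + 1 , - + 2 , + 1) 5 (+ 2) (- + 3) ≡ rhs P (+ 1 , - + 1 , + 1 , - + 1 , - + 2 , + 1) 5 (+ 2) (- + 3)
_ = refl
_ : lhs Q (+ 1 , - + 4 , + 7 , + 2 , - + 7 , + 1) 4 (- + 3) (+ 1) ≡ rhs Q (+ 1 , - + 4 , + 7 , + 2 , - + 7 , + 1) 4 (- + 3) (+ 1)
_ = refl

module Submission where

-- Write E for the shift S ↦ S(· + 1) on two-sided integer sequences and
-- put α = a·E^c, β = b·E^d.  For each of the fifteen tuples, both the Padovan and the
-- Perrin sequence satisfy the shift relation  a·S(k+c) + b·S(k+d) = f·S(k+e),
-- i.e. α + β = f·E^e, while αβ = ab·E^(c+d).  The theorem is then the classical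
-- Lucas (Girard–Waring) expansion
--     α^n + β^n = Σ_j (-1)^j n/(n-j) C(n-j, j) (αβ)^j (α+β)^(n-2j)
-- applied to S at the position (m n + p).

open import Defs
open import Data.Nat using (ℕ; _≥_)
open import Data.Integer using (ℤ)
open import Data.Product using (_×_; _,_)
open import Data.List.Membership.Propositional using (_∈_)
open import Relation.Binary.PropositionalEquality using (_≡_)

module Sequences where

  open import Data.Nat using (zero; suc)
  import Data.Nat.Properties as ℕP
  open import Data.Integer as ℤ using (ℤ; +_; -[1+_]; _+_; _-_; _*_)
  import Data.Integer.Properties as ℤP
  open import Data.Integer.Tactic.RingSolver using (solve-∀)
  open import Data.Product using (_×_; _,_; proj₁)
  open import Data.List.Relation.Unary.All using (All; all?)
  open import Relation.Nullary.Decidable using (Dec; _×-dec_; from-yes)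
  open import Relation.Binary.PropositionalEquality

  state : Triple → ℤ → Triple
  state t (+ n)    = iter fwd n t
  state t -[1+ k ] = iter bwd (suc k) t

  seqAt-state : ∀ t k → seqAt t k ≡ proj₁ (state t k)
  seqAt-state t (+ n)    = refl
  seqAt-state t -[1+ k ] = refl

  fwd-bwd : ∀ x → fwd (bwd x) ≡ x
  fwd-bwd (x₀ , x₁ , x₂) = cong (λ z → x₀ , x₁ , z) (cancel x₂ x₀)
    where
    cancel : ∀ (x y : ℤ) → x - y + y ≡ x
    cancel = solve-∀

  state-suc : ∀ t k → state t (k + + 1) ≡ fwd (state t k)
  state-suc t (+ n)        = cong (λ i → iter fwd i t) (ℕP.+-comm n 1)
  state-suc t -[1+ zero ]  = sym (fwd-bwd t)
  state-suc t -[1+ suc k ] = sym (fwd-bwd (iter bwd (suc k) t))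

  state-+ : ∀ t k n → state t (k + + n) ≡ iter fwd n (state t k)
  state-+ t k zero    = cong (state t) (ℤP.+-identityʳ k)
  state-+ t k (suc n) = begin
      state t (k + + suc n)        ≡⟨ cong (state t) (reassoc k (+ n)) ⟩
      state t (k + + n + + 1)      ≡⟨ state-suc t (k + + n) ⟩
      fwd (state t (k + + n))      ≡⟨ cong fwd (state-+ t k n) ⟩
      fwd (iter fwd n (state t k)) ∎
    where
    open ≡-Reasoning
    reassoc : ∀ (k n : ℤ) → k + (+ 1 + n) ≡ k + n + + 1
    reassoc = solve-∀

  IsPadovanLike : (ℤ → ℤ) → Set
  IsPadovanLike S = ∀ k → S (k + + 3) ≡ S (k + + 1) + S k

  seqAt-padovanLike : ∀ t → IsPadovanLike (seqAt t)
  seqAt-padovanLike t k = begin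
      seqAt t (k + + 3)              ≡⟨ at 3 ⟩
      proj₁ (iter fwd 3 x)           ≡⟨ ℤP.+-comm (proj₁ x) _ ⟩
      proj₁ (iter fwd 1 x) + proj₁ x ≡⟨ cong₂ _+_ (sym (at 1)) (sym (seqAt-state t k)) ⟩
      seqAt t (k + + 1) + seqAt t k  ∎
    where
    open ≡-Reasoning
    x : Triple
    x = state t k
    at : ∀ n → seqAt t (k + + n) ≡ proj₁ (iter fwd n x)
    at n = trans (seqAt-state t (k + + n)) (cong proj₁ (state-+ t k n))

  ZeroTriple : (ℤ → ℤ) → ℤ → Set
  ZeroTriple R k = R k ≡ + 0 × R (k + + 1) ≡ + 0 × R (k + + 2) ≡ + 0

  zeroTriple? : ∀ R k → Dec (ZeroTriple R k)
  zeroTriple? R k = (R k ℤ.≟ + 0) ×-dec (R (k + + 1) ℤ.≟ + 0) ×-dec (R (k + + 2) ℤ.≟ + 0)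

  module _ {R : ℤ → ℤ} (padovan : IsPadovanLike R) where

    private
      +1+1 : ∀ k → k + + 1 + + 1 ≡ k + + 2
      +1+1 = solve-∀
      +1+2 : ∀ k → k + + 1 + + 2 ≡ k + + 3
      +1+2 = solve-∀
      difference : ∀ (x y : ℤ) → y ≡ (x + y) - x
      difference = solve-∀

    zeros-forward : ∀ k → ZeroTriple R k → ZeroTriple R (k + + 1)
    zeros-forward k (z₀ , z₁ , z₂) =
      z₁ , subst (λ i → R i ≡ + 0) (sym (+1+1 k)) z₂ ,
      (begin
        R (k + + 1 + + 2) ≡⟨ cong R (+1+2 k) ⟩
        R (k + + 3)       ≡⟨ padovan k ⟩
        R (k + + 1) + R k ≡⟨ cong₂ _+_ z₁ z₀ ⟩
        + 0               ∎)
      where open ≡-Reasoning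

    zeros-backward : ∀ k → ZeroTriple R (k + + 1) → ZeroTriple R k
    zeros-backward k (z₁ , z₂ , z₃) =
      (begin
        R k                               ≡⟨ difference (R (k + + 1)) (R k) ⟩
        (R (k + + 1) + R k) - R (k + + 1) ≡⟨ cong (_- R (k + + 1)) (sym (padovan k)) ⟩
        R (k + + 3) - R (k + + 1)         ≡⟨ cong₂ _-_ (trans (cong R (sym (+1+2 k))) z₃) z₁ ⟩
        + 0                               ∎) ,
      z₁ , subst (λ i → R i ≡ + 0) (+1+1 k) z₂
      where open ≡-Reasoning

    zeros-everywhere : ZeroTriple R (+ 0) → ∀ k → R k ≡ + 0
    zeros-everywhere initial k = proj₁ (from k)
      where
      up : ∀ n → ZeroTriple R (+ n)
      up zero    = initial
      up (suc n) = subst (ZeroTriple R) (cong +_ (ℕP.+-comm n 1)) (zeros-forward (+ n) (up n))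
      down : ∀ n → ZeroTriple R -[1+ n ]
      down zero    = zeros-backward -[1+ 0 ] initial
      down (suc n) = zeros-backward -[1+ suc n ] (down n)
      from : ∀ k → ZeroTriple R k
      from (+ n)    = up n
      from -[1+ n ] = down n

  ShiftRelation : Tuple6 → (ℤ → ℤ) → Set
  ShiftRelation (a , b , c , d , e , f) S = ∀ k → a * S (k + c) + b * S (k + d) ≡ f * S (k + e)

  defect : Tuple6 → (ℤ → ℤ) → ℤ → ℤ
  defect (a , b , c , d , e , f) S k = a * S (k + c) + b * S (k + d) - f * S (k + e)

  -- The defect is a fixed linear combination of shifts of S, hence Padovan-like with S.
  defect-padovanLike : ∀ t S → IsPadovanLike S → IsPadovanLike (defect t S)
  defect-padovanLike t@(a , b , c , d , e , f) S padovan k = begin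
      a * S (k + + 3 + c) + b * S (k + + 3 + d) - f * S (k + + 3 + e)
    ≡⟨ cong₂ _-_ (cong₂ _+_ (cong (a *_) (step c)) (cong (b *_) (step d))) (cong (f *_) (step e)) ⟩
      a * (S (k + + 1 + c) + S (k + c)) + b * (S (k + + 1 + d) + S (k + d))
        - f * (S (k + + 1 + e) + S (k + e))
    ≡⟨ regroup a b f (S (k + + 1 + c)) (S (k + c)) (S (k + + 1 + d)) (S (k + d))
                     (S (k + + 1 + e)) (S (k + e)) ⟩
      defect t S (k + + 1) + defect t S k
    ∎
    where
    open ≡-Reasoning
    swap : ∀ (k x m : ℤ) → k + m + x ≡ k + x + m
    swap = solve-∀
    step : ∀ x → S (k + + 3 + x) ≡ S (k + + 1 + x) + S (k + x)
    step x = begin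
      S (k + + 3 + x)             ≡⟨ cong S (swap k x (+ 3)) ⟩
      S (k + x + + 3)             ≡⟨ padovan (k + x) ⟩
      S (k + x + + 1) + S (k + x) ≡⟨ cong (λ i → S i + S (k + x)) (swap k (+ 1) x) ⟩
      S (k + + 1 + x) + S (k + x) ∎
    regroup : ∀ (a b f x₁ x₀ y₁ y₀ z₁ z₀ : ℤ) →
      a * (x₁ + x₀) + b * (y₁ + y₀) - f * (z₁ + z₀) ≡ (a * x₁ + b * y₁ - f * z₁) + (a * x₀ + b * y₀ - f * z₀)
    regroup = solve-∀

  shiftRelation-from-initial : ∀ t S → IsPadovanLike S → ZeroTriple (defect t S) (+ 0) → ShiftRelation t S
  shiftRelation-from-initial t@(a , b , c , d , e , f) S padovan initial k =
    ℤP.i-j≡0⇒i≡j _ _ (zeros-everywhere (defect-padovanLike t S padovan) initial k)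

  InitialCheck : Tuple6 → Set
  InitialCheck t = ZeroTriple (defect t P) (+ 0) × ZeroTriple (defect t Q) (+ 0)

  initialChecks : All InitialCheck tuples
  initialChecks =
    from-yes (all? (λ t → zeroTriple? (defect t P) (+ 0) ×-dec zeroTriple? (defect t Q) (+ 0)) tuples)

module Sums where

  open import Data.Nat using (zero; suc; _≤_; s≤s; z≤n; _/_)
  import Data.Nat.Properties as ℕP
  open import Data.Integer using (ℤ; +_; _+_; _*_)
  import Data.Integer.Properties as ℤP
  open import Data.Integer.Tactic.RingSolver using (solve-∀)
  open import Data.List using (map; foldr; applyUpTo)
  open import Data.Sum using (inj₁; inj₂)
  open import Function using (_∘_; id)
  open import Relation.Binary.PropositionalEquality

  sumBelow : ℕ → (ℕ → ℤ) → ℤ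
  sumBelow zero    T = + 0
  sumBelow (suc N) T = T 0 + sumBelow N (T ∘ suc)

  foldr-applyUpTo : ∀ (g : ℕ → ℤ) (h : ℕ → ℕ) N →
    foldr _+_ (+ 0) (map g (applyUpTo h N)) ≡ sumBelow N (g ∘ h)
  foldr-applyUpTo g h zero    = refl
  foldr-applyUpTo g h (suc N) = cong (λ s → g (h 0) + s) (foldr-applyUpTo g (h ∘ suc) N)

  sumHalf≡sumBelow : ∀ n g → sumHalf n g ≡ sumBelow (suc (n / 2)) g
  sumHalf≡sumBelow n g = foldr-applyUpTo g id (suc (n / 2))

  sumBelow-cong : ∀ N {T T′ : ℕ → ℤ} → (∀ j → T j ≡ T′ j) → sumBelow N T ≡ sumBelow N T′
  sumBelow-cong zero    eq = refl
  sumBelow-cong (suc N) eq = cong₂ _+_ (eq 0) (sumBelow-cong N (eq ∘ suc))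

  sumBelow-snoc : ∀ N T → sumBelow (suc N) T ≡ sumBelow N T + T N
  sumBelow-snoc zero    T = ℤP.+-comm (T 0) (+ 0)
  sumBelow-snoc (suc N) T =
    trans (cong (λ s → T 0 + s) (sumBelow-snoc N (T ∘ suc))) (sym (ℤP.+-assoc (T 0) _ _))

  sumBelow-add : ∀ N (A B : ℕ → ℤ) → sumBelow N (λ j → A j + B j) ≡ sumBelow N A + sumBelow N B
  sumBelow-add zero    A B = refl
  sumBelow-add (suc N) A B =
    trans (cong (λ s → A 0 + B 0 + s) (sumBelow-add N (A ∘ suc) (B ∘ suc))) (interchange (A 0) (B 0) _ _)
    where
    interchange : ∀ (a b c d : ℤ) → (a + b) + (c + d) ≡ (a + c) + (b + d)
    interchange = solve-∀

  sumBelow-scale : ∀ N x (A : ℕ → ℤ) → sumBelow N (λ j → x * A j) ≡ x * sumBelow N A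
  sumBelow-scale zero    x A = sym (ℤP.*-zeroʳ x)
  sumBelow-scale (suc N) x A =
    trans (cong (λ s → x * A 0 + s) (sumBelow-scale N x (A ∘ suc))) (sym (ℤP.*-distribˡ-+ x (A 0) _))

  sumBelow-extend : ∀ (T : ℕ → ℤ) L N → (∀ j → L ≤ j → T j ≡ + 0) → L ≤ N → sumBelow N T ≡ sumBelow L T
  sumBelow-extend T L zero    vanish z≤n = refl
  sumBelow-extend T L (suc N) vanish L≤1+N with ℕP.m≤n⇒m<n∨m≡n L≤1+N
  ... | inj₂ refl     = refl
  ... | inj₁ (s≤s L≤N) = begin
      sumBelow (suc N) T  ≡⟨ sumBelow-snoc N T ⟩
      sumBelow N T + T N  ≡⟨ cong (λ s → sumBelow N T + s) (vanish N L≤N) ⟩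
      sumBelow N T + + 0  ≡⟨ ℤP.+-identityʳ _ ⟩
      sumBelow N T        ≡⟨ sumBelow-extend T L N vanish L≤N ⟩
      sumBelow L T        ∎
    where open ≡-Reasoning

  sumBelow-recurrence : ∀ N (f g : ℤ) (U V W : ℕ → ℤ) →
    U 0 ≡ f * V 0 → (∀ j → U (suc j) ≡ f * V (suc j) + g * W j) →
    sumBelow (suc N) U ≡ f * sumBelow (suc N) V + g * sumBelow N W
  sumBelow-recurrence N f g U V W head step = begin
      U 0 + sumBelow N (U ∘ suc)
    ≡⟨ cong₂ _+_ head (sumBelow-cong N step) ⟩
      f * V 0 + sumBelow N (λ j → f * V (suc j) + g * W j)
    ≡⟨ cong (λ s → f * V 0 + s) (sumBelow-add N (λ j → f * V (suc j)) (λ j → g * W j)) ⟩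
      f * V 0 + (sumBelow N (λ j → f * V (suc j)) + sumBelow N (λ j → g * W j))
    ≡⟨ cong₂ (λ x y → f * V 0 + (x + y)) (sumBelow-scale N f (V ∘ suc)) (sumBelow-scale N g W) ⟩
      f * V 0 + (f * sumBelow N (V ∘ suc) + g * sumBelow N W)
    ≡⟨ factor f (V 0) _ g _ ⟩
      f * (V 0 + sumBelow N (V ∘ suc)) + g * sumBelow N W
    ∎
    where
    open ≡-Reasoning
    factor : ∀ (f v s g w : ℤ) → f * v + (f * s + g * w) ≡ f * (v + s) + g * w
    factor = solve-∀

-- The Lucas coefficients L(n, j): x^n + y^n = Σ_j (-1)^j L(n, j) (xy)^j (x+y)^(n-2j).
module LucasCoefficients where

  open import Data.Nat
  import Data.Nat.Properties as ℕP
  open import Data.Nat.Combinatorics using (_C_; nCk+nC[k+1]≡[n+1]C[k+1]; k>n⇒nCk≡0; nC1≡n)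
  open import Data.Nat.DivMod using (_/_; m*n/n≡m; /-monoˡ-≤)
  open import Data.Nat.Tactic.RingSolver using (solve-∀)
  open import Data.Empty using (⊥-elim)
  open import Relation.Nullary using (yes; no)
  open import Relation.Binary.PropositionalEquality

  pascal : ∀ k j → suc k C suc j ≡ k C j + k C suc j
  pascal k j = sym (nCk+nC[k+1]≡[n+1]C[k+1] k j)

  absorption : ∀ k j → suc j * (suc k C suc j) ≡ suc k * (k C j)
  absorption zero    zero    = refl
  absorption zero    (suc j) = ℕP.*-zeroʳ (suc (suc j))
  absorption (suc k) zero    =
    trans (ℕP.*-identityˡ _) (trans (nC1≡n (suc (suc k))) (sym (ℕP.*-identityʳ _)))
  absorption (suc k) (suc j) = begin
      (2 + j) * ((2 + k) C (2 + j))
    ≡⟨ cong ((2 + j) *_) (pascal (suc k) (suc j)) ⟩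
      (2 + j) * (x + y)
    ≡⟨ expand j x y ⟩
      (1 + j) * x + x + (2 + j) * y
    ≡⟨ cong₂ (λ u v → u + x + v) (absorption k j) (absorption k (suc j)) ⟩
      (1 + k) * (k C j) + x + (1 + k) * (k C suc j)
    ≡⟨ collect k x (k C j) (k C suc j) ⟩
      x + (1 + k) * (k C j + k C suc j)
    ≡⟨ cong (λ z → x + (1 + k) * z) (sym (pascal k j)) ⟩
      (2 + k) * x
    ∎
    where
    open ≡-Reasoning
    x = suc k C suc j
    y = suc k C (2 + j)
    expand : ∀ j x y → (2 + j) * (x + y) ≡ (1 + j) * x + x + (2 + j) * y
    expand = solve-∀
    collect : ∀ k x u v → (1 + k) * u + x + (1 + k) * v ≡ x + (1 + k) * (u + v)
    collect = solve-∀

  -- C(k-1, j-1), with the convention C(-1, -1) = 1 and C(-1, j) = C(k, -1) = 0 otherwise.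
  binom-pred : ℕ → ℕ → ℕ
  binom-pred zero    zero    = 1
  binom-pred (suc k) (suc j) = k C j
  binom-pred _       _       = 0

  -- With this convention Pascal's rule holds for binom-pred without exception.
  binom-pred-pascal : ∀ k j → binom-pred k (suc j) + binom-pred k j ≡ k C j
  binom-pred-pascal zero    zero    = refl
  binom-pred-pascal zero    (suc j) = refl
  binom-pred-pascal (suc k) zero    = refl
  binom-pred-pascal (suc k) (suc j) = trans (ℕP.+-comm (k C suc j) (k C j)) (nCk+nC[k+1]≡[n+1]C[k+1] k j)

  -- L(k + j, j) in terms of the complementary index k = n - j.
  lucas′ : ℕ → ℕ → ℕ
  lucas′ k j = k C j + binom-pred k j

  -- L(n, j) = C(n-j, j) + C(n-j-1, j-1); note L(0, 0) = 2 = x⁰ + y⁰.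
  lucas : ℕ → ℕ → ℕ
  lucas n j = lucas′ (n ∸ j) j

  lucas′-vanish : ∀ k j → k < j → lucas′ k j ≡ 0
  lucas′-vanish zero    (suc j) _         = refl
  lucas′-vanish (suc k) (suc j) (s≤s k<j) = cong₂ _+_ (k>n⇒nCk≡0 (s≤s k<j)) (k>n⇒nCk≡0 k<j)

  lucas-vanish : ∀ n j → n < 2 * j → lucas n j ≡ 0
  lucas-vanish n zero    ()
  lucas-vanish n (suc j) n<2j = lucas′-vanish (n ∸ suc j) (suc j)
    (ℕP.m<n+o⇒m∸n<o n (suc j) (subst (n <_) (cong (suc j +_) (ℕP.+-identityʳ (suc j))) n<2j))

  lucas-vanish-beyond-half : ∀ n j → n / 2 < j → lucas n j ≡ 0
  lucas-vanish-beyond-half n j half<j with n <? 2 * j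
  ... | yes n<2j = lucas-vanish n j n<2j
  ... | no  n≮2j = ⊥-elim (ℕP.<⇒≱ half<j j≤half)
    where
    j≤half : j ≤ n / 2
    j≤half = subst (_≤ n / 2) (trans (cong (_/ 2) (ℕP.*-comm 2 j)) (m*n/n≡m j 2)) (/-monoˡ-≤ 2 (ℕP.≮⇒≥ n≮2j))

  -- (n - j)·L(n, j) = n·C(n - j, j), written with k + 1 = n - j.
  lucas′-absorption : ∀ k j → lucas′ (suc k) j * suc k ≡ (suc k + j) * (suc k C j)
  lucas′-absorption k zero    = base k
    where
    base : ∀ k → 1 * suc k ≡ (suc k + 0) * 1
    base = solve-∀
  lucas′-absorption k (suc j) = begin
      (x + z) * suc k       ≡⟨ distrib x z k ⟩
      x * suc k + suc k * z ≡⟨ cong (x * suc k +_) (sym (absorption k j)) ⟩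
      x * suc k + suc j * x ≡⟨ collect x k j ⟩
      (suc k + suc j) * x   ∎
    where
    open ≡-Reasoning
    x = suc k C suc j
    z = k C j
    distrib : ∀ x z k → (x + z) * suc k ≡ x * suc k + suc k * z
    distrib = solve-∀
    collect : ∀ x k j → x * suc k + suc j * x ≡ (suc k + suc j) * x
    collect = solve-∀

  coeff≡lucas : ∀ n j → 1 ≤ n → coeff n j ≡ lucas n j
  coeff≡lucas n j 1≤n with n ∸ j in eq
  coeff≡lucas n zero    1≤n | zero  = ⊥-elim (ℕP.<⇒≢ 1≤n (sym eq))
  coeff≡lucas n (suc j) 1≤n | zero  = refl
  coeff≡lucas n j       1≤n | suc k rewrite eq = begin
      n * (suc k C j) / suc k           ≡⟨ cong (λ m → m * (suc k C j) / suc k) n≡ ⟩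
      (suc k + j) * (suc k C j) / suc k ≡⟨ cong (_/ suc k) (sym (lucas′-absorption k j)) ⟩
      lucas′ (suc k) j * suc k / suc k  ≡⟨ m*n/n≡m (lucas′ (suc k) j) (suc k) ⟩
      lucas′ (suc k) j                  ∎
    where
    open ≡-Reasoning
    j<n : j < n
    j<n = ℕP.m∸n≢0⇒n<m (λ n∸j≡0 → ℕP.1+n≢0 (trans (sym eq) n∸j≡0))
    n≡ : n ≡ suc k + j
    n≡ = trans (sym (ℕP.m∸n+n≡m {n} {j} (ℕP.<⇒≤ j<n))) (cong (_+ j) eq)

  lucas′-rec : ∀ k j → lucas′ (suc k) (suc j) ≡ lucas′ k (suc j) + lucas′ k j
  lucas′-rec k j = begin
      suc k C suc j + k C j
    ≡⟨ cong (_+ k C j) (pascal k j) ⟩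
      (k C j + k C suc j) + k C j
    ≡⟨ cong ((k C j + k C suc j) +_) (sym (binom-pred-pascal k j)) ⟩
      (k C j + k C suc j) + (binom-pred k (suc j) + binom-pred k j)
    ≡⟨ regroup (k C j) (k C suc j) (binom-pred k (suc j)) (binom-pred k j) ⟩
      (k C suc j + binom-pred k (suc j)) + (k C j + binom-pred k j)
    ∎
    where
    open ≡-Reasoning
    regroup : ∀ a b c d → (a + b) + (c + d) ≡ (b + c) + (a + d)
    regroup = solve-∀

  lucas-rec : ∀ n j → lucas (2 + n) (suc j) ≡ lucas (suc n) (suc j) + lucas n j
  lucas-rec n j with j ≤? n
  ... | yes j≤n rewrite ℕP.+-∸-assoc 1 j≤n = lucas′-rec (n ∸ j) j
  -- for j > n all three complementary indices are 0 and all three coefficients vanish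
  ... | no  j≰n with ℕP.≰⇒> j≰n
  ...   | n<j@(s≤s _) rewrite ℕP.m≤n⇒m∸n≡0 n<j | ℕP.m≤n⇒m∸n≡0 (ℕP.<⇒≤ n<j) = refl

open Sequences
open Sums
open LucasCoefficients

-- The Lucas expansion for an arbitrary sequence S satisfying the shift relation of
-- (a, b, c, d, e, f): formally α^n + β^n with α = a·E^c, β = b·E^d, α + β = f·E^e.
module LucasExpansion (a b c d e f : ℤ) (S : ℤ → ℤ)
                      (relation : ShiftRelation (a , b , c , d , e , f) S) where

  open import Data.Nat as ℕ using (zero; suc; _≤_; _<_; _∸_; s≤s; _/_; _≤?_)
  import Data.Nat.Properties as ℕP
  open import Data.Nat.DivMod using (m/n≤m)
  open import Data.Integer using (+_; _+_; _-_; _*_; _^_; -_)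
  import Data.Integer.Properties as ℤP
  open import Data.Integer.Tactic.RingSolver using (solve-∀)
  open import Relation.Nullary using (yes; no)
  open import Relation.Binary.PropositionalEquality

  relation-at : ∀ k {x y z} → k + c ≡ x → k + d ≡ y → k + e ≡ z → a * S x + b * S y ≡ f * S z
  relation-at k refl refl refl = relation k

  -- Each factor αβ (α+β)^(-2) moves the position by c + d - 2e.
  D : ℤ
  D = c - + 2 * e + d

  term : ℕ → ℤ → ℕ → ℤ
  term n k j = sgn j * + lucas n j * a ^ j * b ^ j * f ^ (n ∸ 2 ℕ.* j) * S (k + e * + n + D * + j)

  -- The left-hand side, summed over all j ≤ n (the summands with 2j > n vanish).
  lucasSum : ℕ → ℤ → ℤ
  lucasSum n k = sumBelow (suc n) (term n k)

  powerSum : ℕ → ℤ → ℤ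
  powerSum n k = a ^ n * S (k + c * + n) + b ^ n * S (k + d * + n)

  -- The power sums obey  X (n+2) k = f · X (n+1) (k+e) - ab · X n (k+c+d),
  -- the operator identity α^(n+2) + β^(n+2) = (α+β)(α^(n+1) + β^(n+1)) - αβ(α^n + β^n).
  powerSum-rec : ∀ n k →
    powerSum (suc (suc n)) k ≡ f * powerSum (suc n) (k + e) - a * b * powerSum n (k + c + d)
  powerSum-rec n k = begin
      a * (a * α) * X₁ + b * (b * β) * X₂
    ≡⟨ expand a b α β X₁ Y₁ X₂ Y₂ ⟩
      a * α * (a * X₁ + b * Y₁) + b * β * (a * Y₂ + b * X₂) - a * b * (α * Y₁ + β * Y₂)
    ≡⟨ cong₂ (λ u v → a * α * u + b * β * v - a * b * (α * Y₁ + β * Y₂)) first second ⟩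
      a * α * (f * Z₁) + b * β * (f * Z₂) - a * b * (α * Y₁ + β * Y₂)
    ≡⟨ collect a b f α β Y₁ Z₁ Y₂ Z₂ ⟩
      f * (a * α * Z₁ + b * β * Z₂) - a * b * (α * Y₁ + β * Y₂)
    ∎
    where
    open ≡-Reasoning
    N = + n
    α = a ^ n
    β = b ^ n
    X₁ = S (k + c * (+ 2 + N))
    Y₁ = S (k + c + d + c * N)
    Z₁ = S (k + e + c * (+ 1 + N))
    X₂ = S (k + d * (+ 2 + N))
    Y₂ = S (k + c + d + d * N)
    Z₂ = S (k + e + d * (+ 1 + N))
    one-more : ∀ (k x N : ℤ) → k + x * (+ 1 + N) + x ≡ k + x * (+ 2 + N)
    one-more = solve-∀
    to-cd : ∀ (k c d N : ℤ) → k + c * (+ 1 + N) + d ≡ k + c + d + c * N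
    to-cd = solve-∀
    to-cd′ : ∀ (k c d N : ℤ) → k + d * (+ 1 + N) + c ≡ k + c + d + d * N
    to-cd′ = solve-∀
    to-e : ∀ (k x e N : ℤ) → k + x * (+ 1 + N) + e ≡ k + e + x * (+ 1 + N)
    to-e = solve-∀
    first : a * X₁ + b * Y₁ ≡ f * Z₁
    first = relation-at (k + c * (+ 1 + N)) (one-more k c N) (to-cd k c d N) (to-e k c e N)
    second : a * Y₂ + b * X₂ ≡ f * Z₂
    second = relation-at (k + d * (+ 1 + N)) (to-cd′ k c d N) (one-more k d N) (to-e k d e N)
    expand : ∀ (a b α β X₁ Y₁ X₂ Y₂ : ℤ) → a * (a * α) * X₁ + b * (b * β) * X₂ ≡
      a * α * (a * X₁ + b * Y₁) + b * β * (a * Y₂ + b * X₂) - a * b * (α * Y₁ + β * Y₂)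
    expand = solve-∀
    collect : ∀ (a b f α β Y₁ Z₁ Y₂ Z₂ : ℤ) →
      a * α * (f * Z₁) + b * β * (f * Z₂) - a * b * (α * Y₁ + β * Y₂) ≡
      f * (a * α * Z₁ + b * β * Z₂) - a * b * (α * Y₁ + β * Y₂)
    collect = solve-∀

  term-vanish : ∀ n k j → lucas n j ≡ 0 → term n k j ≡ + 0
  term-vanish n k j lucas≡0 rewrite lucas≡0 = zero-factor (sgn j) _ _ _ _
    where
    zero-factor : ∀ (σ A B Φ s : ℤ) → σ * + 0 * A * B * Φ * s ≡ + 0
    zero-factor = solve-∀

  -- The summand j = 0: L(n, 0) = 1 for n ≥ 1, so it is f^n S(k + en).
  term-head : ∀ n k → term (suc (suc n)) k 0 ≡ f * term (suc n) (k + e) 0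
  term-head n k =
    trans (cong (λ i → + 1 * + 1 * + 1 * + 1 * (f * f ^ suc n) * S i) (reposition k e D (+ n)))
          (pull-f f (f ^ suc n) _)
    where
    reposition : ∀ (k e D N : ℤ) → k + e * (+ 2 + N) + D * + 0 ≡ k + e + e * (+ 1 + N) + D * + 0
    reposition = solve-∀
    pull-f : ∀ (f Φ s : ℤ) → + 1 * + 1 * + 1 * + 1 * (f * Φ) * s ≡ f * (+ 1 * + 1 * + 1 * + 1 * Φ * s)
    pull-f = solve-∀

  ∸-step : ∀ m n → m < n → n ∸ m ≡ suc (n ∸ suc m)
  ∸-step zero    (suc n) _         = refl
  ∸-step (suc m) (suc n) (s≤s m<n) = ∸-step m n m<n

  -- One factor f can be split off f^(n-2j) whenever L(n+1, j+1) ≠ 0, i.e. 2j < n.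
  power-shift : ∀ n j →
    + lucas (suc n) (suc j) * f ^ (n ∸ 2 ℕ.* j) ≡ + lucas (suc n) (suc j) * (f * f ^ (n ∸ suc (2 ℕ.* j)))
  power-shift n j with suc (2 ℕ.* j) ≤? n
  ... | yes 2j<n = cong (λ x → + lucas (suc n) (suc j) * f ^ x) (∸-step (2 ℕ.* j) n 2j<n)
  ... | no  2j≮n
    rewrite lucas-vanish (suc n) (suc j) (subst (suc n <_) (sym (ℕP.*-suc 2 j)) (s≤s (ℕP.≰⇒> 2j≮n))) =
    trans (ℤP.*-zeroˡ (f ^ (n ∸ 2 ℕ.* j))) (sym (ℤP.*-zeroˡ (f * f ^ (n ∸ suc (2 ℕ.* j)))))

  -- The summands j + 1 follow the Lucas recurrence of their coefficients.
  term-step : ∀ n k j →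
    term (suc (suc n)) k (suc j) ≡ f * term (suc n) (k + e) (suc j) + - (a * b) * term n (k + c + d) j
  term-step n k j = begin
      term (suc (suc n)) k (suc j)
    ≡⟨ cong₂ (λ L x → (- σ) * + L * (a * A) * (b * B) * f ^ x * s) (lucas-rec n j) (exponent-2 n j) ⟩
      (- σ) * (L₁ + L₀) * (a * A) * (b * B) * Φ₀ * s
    ≡⟨ split σ L₁ L₀ a A b B Φ₀ s ⟩
      (- σ) * (a * A) * (b * B) * s * (L₁ * Φ₀) + σ * L₀ * A * B * Φ₀ * s * - (a * b)
    ≡⟨ cong (λ x → (- σ) * (a * A) * (b * B) * s * x + σ * L₀ * A * B * Φ₀ * s * - (a * b)) (power-shift n j) ⟩
      (- σ) * (a * A) * (b * B) * s * (L₁ * (f * Φ₁)) + σ * L₀ * A * B * Φ₀ * s * - (a * b)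
    ≡⟨ regroup σ L₁ L₀ a A b B f Φ₀ Φ₁ s ⟩
      f * ((- σ) * L₁ * (a * A) * (b * B) * Φ₁ * s) + - (a * b) * (σ * L₀ * A * B * Φ₀ * s)
    ≡⟨ sym (cong₂ (λ u v → f * u + - (a * b) * v)
         (cong₂ (λ x i → (- σ) * L₁ * (a * A) * (b * B) * f ^ x * S i) (exponent-1 n j) (position-1 k e D (+ n) (+ j)))
         (cong (λ i → σ * L₀ * A * B * Φ₀ * S i) (position-0 k c d e (+ n) (+ j)))) ⟩
      f * term (suc n) (k + e) (suc j) + - (a * b) * term n (k + c + d) j
    ∎
    where
    open ≡-Reasoning
    σ = sgn j
    L₁ = + lucas (suc n) (suc j)
    L₀ = + lucas n j
    A = a ^ j
    B = b ^ j
    Φ₀ = f ^ (n ∸ 2 ℕ.* j)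
    Φ₁ = f ^ (n ∸ suc (2 ℕ.* j))
    s = S (k + e * (+ 2 + + n) + D * (+ 1 + + j))
    exponent-2 : ∀ n j → suc (suc n) ∸ 2 ℕ.* suc j ≡ n ∸ 2 ℕ.* j
    exponent-2 n j = cong (suc (suc n) ∸_) (ℕP.*-suc 2 j)
    exponent-1 : ∀ n j → suc n ∸ 2 ℕ.* suc j ≡ n ∸ suc (2 ℕ.* j)
    exponent-1 n j = cong (suc n ∸_) (ℕP.*-suc 2 j)
    position-1 : ∀ (k e D N J : ℤ) → k + e + e * (+ 1 + N) + D * (+ 1 + J) ≡ k + e * (+ 2 + N) + D * (+ 1 + J)
    position-1 = solve-∀
    position-0 : ∀ (k c d e N J : ℤ) →
      k + c + d + e * N + (c - + 2 * e + d) * J ≡ k + e * (+ 2 + N) + (c - + 2 * e + d) * (+ 1 + J)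
    position-0 = solve-∀
    split : ∀ (σ L₁ L₀ a A b B Φ₀ s : ℤ) → (- σ) * (L₁ + L₀) * (a * A) * (b * B) * Φ₀ * s ≡
      (- σ) * (a * A) * (b * B) * s * (L₁ * Φ₀) + σ * L₀ * A * B * Φ₀ * s * - (a * b)
    split = solve-∀
    regroup : ∀ (σ L₁ L₀ a A b B f Φ₀ Φ₁ s : ℤ) →
      (- σ) * (a * A) * (b * B) * s * (L₁ * (f * Φ₁)) + σ * L₀ * A * B * Φ₀ * s * - (a * b) ≡
      f * ((- σ) * L₁ * (a * A) * (b * B) * Φ₁ * s) + - (a * b) * (σ * L₀ * A * B * Φ₀ * s)
    regroup = solve-∀

  lucasSum-rec : ∀ n k →
    lucasSum (suc (suc n)) k ≡ f * lucasSum (suc n) (k + e) - a * b * lucasSum n (k + c + d)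
  lucasSum-rec n k = begin
      sumBelow (3 ℕ.+ n) T₂
    ≡⟨ sumBelow-recurrence (2 ℕ.+ n) f (- (a * b)) T₂ T₁ T₀ (term-head n k) (term-step n k) ⟩
      f * sumBelow (3 ℕ.+ n) T₁ + - (a * b) * sumBelow (2 ℕ.+ n) T₀
    ≡⟨ cong₂ (λ u v → f * u + - (a * b) * v) (drop-top (suc n) (k + e)) (drop-top n (k + c + d)) ⟩
      f * sumBelow (2 ℕ.+ n) T₁ + - (a * b) * sumBelow (suc n) T₀
    ≡⟨ negate f (sumBelow (2 ℕ.+ n) T₁) a b (sumBelow (suc n) T₀) ⟩
      f * lucasSum (suc n) (k + e) - a * b * lucasSum n (k + c + d)
    ∎
    where
    open ≡-Reasoning
    T₂ = term (suc (suc n)) k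
    T₁ = term (suc n) (k + e)
    T₀ = term n (k + c + d)
    below-double : ∀ n j → n < j → n < 2 ℕ.* j
    below-double n j n<j = ℕP.<-≤-trans n<j (ℕP.m≤n*m j 2)
    drop-top : ∀ n k → sumBelow (2 ℕ.+ n) (term n k) ≡ sumBelow (suc n) (term n k)
    drop-top n k = sumBelow-extend (term n k) (suc n) (2 ℕ.+ n)
      (λ j n<j → term-vanish n k j (lucas-vanish n j (below-double n j n<j))) (ℕP.n≤1+n _)
    negate : ∀ (f u a b v : ℤ) → f * u + - (a * b) * v ≡ f * u - a * b * v
    negate = solve-∀

  lucasSum-0 : ∀ k → lucasSum 0 k ≡ powerSum 0 k
  lucasSum-0 k = begin
      + 1 * + 2 * + 1 * + 1 * + 1 * S (k + e * + 0 + D * + 0) + + 0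
    ≡⟨ cong (λ i → + 1 * + 2 * + 1 * + 1 * + 1 * S i + + 0) (at-origin k e D) ⟩
      + 1 * + 2 * + 1 * + 1 * + 1 * S k + + 0
    ≡⟨ twice (S k) ⟩
      + 1 * S k + + 1 * S k
    ≡⟨ cong₂ (λ i i′ → + 1 * S i + + 1 * S i′) (unshifted k c) (unshifted k d) ⟩
      powerSum 0 k
    ∎
    where
    open ≡-Reasoning
    at-origin : ∀ (k e D : ℤ) → k + e * + 0 + D * + 0 ≡ k
    at-origin = solve-∀
    unshifted : ∀ (k c : ℤ) → k ≡ k + c * + 0
    unshifted = solve-∀
    twice : ∀ (x : ℤ) → + 1 * + 2 * + 1 * + 1 * + 1 * x + + 0 ≡ + 1 * x + + 1 * x
    twice = solve-∀

  -- For n = 1 the identity is the shift relation itself.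
  lucasSum-1 : ∀ k → lucasSum 1 k ≡ powerSum 1 k
  lucasSum-1 k = begin
      term 1 k 0 + (term 1 k 1 + + 0)
    ≡⟨ cong (λ x → term 1 k 0 + (x + + 0)) (term-vanish 1 k 1 refl) ⟩
      + 1 * + 1 * + 1 * + 1 * (f * + 1) * S i + (+ 0 + + 0)
    ≡⟨ single f (S i) ⟩
      f * S i
    ≡⟨ sym (relation-at k (times-one k c) (times-one k d) (position k e D)) ⟩
      a * S (k + c * + 1) + b * S (k + d * + 1)
    ≡⟨ times-one′ a b (S (k + c * + 1)) (S (k + d * + 1)) ⟩
      powerSum 1 k
    ∎
    where
    open ≡-Reasoning
    i = k + e * + 1 + D * + 0
    single : ∀ (f x : ℤ) → + 1 * + 1 * + 1 * + 1 * (f * + 1) * x + (+ 0 + + 0) ≡ f * x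
    single = solve-∀
    times-one : ∀ (k c : ℤ) → k + c ≡ k + c * + 1
    times-one = solve-∀
    position : ∀ (k e D : ℤ) → k + e ≡ k + e * + 1 + D * + 0
    position = solve-∀
    times-one′ : ∀ (a b x y : ℤ) → a * x + b * y ≡ a * + 1 * x + b * + 1 * y
    times-one′ = solve-∀

  lucasSum≡powerSum : ∀ n k → lucasSum n k ≡ powerSum n k
  lucasSum≡powerSum zero          k = lucasSum-0 k
  lucasSum≡powerSum (suc zero)    k = lucasSum-1 k
  lucasSum≡powerSum (suc (suc n)) k = begin
      lucasSum (suc (suc n)) k
    ≡⟨ lucasSum-rec n k ⟩
      f * lucasSum (suc n) (k + e) - a * b * lucasSum n (k + c + d)
    ≡⟨ cong₂ (λ u v → f * u - a * b * v) (lucasSum≡powerSum (suc n) (k + e)) (lucasSum≡powerSum n (k + c + d)) ⟩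
      f * powerSum (suc n) (k + e) - a * b * powerSum n (k + c + d)
    ≡⟨ sym (powerSum-rec n k) ⟩
      powerSum (suc (suc n)) k
    ∎
    where open ≡-Reasoning

  identity : ∀ n → 1 ≤ n → ∀ m p → lhs S (a , b , c , d , e , f) n m p ≡ rhs S (a , b , c , d , e , f) n m p
  identity n 1≤n m p = begin
      lhs S (a , b , c , d , e , f) n m p
    ≡⟨ sumHalf≡sumBelow n summand ⟩
      sumBelow (suc (n / 2)) summand
    ≡⟨ sumBelow-cong (suc (n / 2)) summand≡term ⟩
      sumBelow (suc (n / 2)) (term n k)
    ≡⟨ sumBelow-extend (term n k) (suc (n / 2)) (suc n) beyond-half (s≤s (m/n≤m n 2)) ⟨
      lucasSum n k
    ≡⟨ lucasSum≡powerSum n k ⟩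
      powerSum n k
    ≡⟨ cong₂ (λ x y → a ^ n * S x + b ^ n * S y) (reposition m p c (+ n)) (reposition m p d (+ n)) ⟩
      rhs S (a , b , c , d , e , f) n m p
    ∎
    where
    open ≡-Reasoning
    k = m * + n + p
    summand : ℕ → ℤ
    summand j = sgn j * + coeff n j * a ^ j * b ^ j * f ^ (n ∸ 2 ℕ.* j) * S ((m + e) * + n + p + D * + j)
    position : ∀ (m p c d e n j : ℤ) → (m + e) * n + p + (c - + 2 * e + d) * j ≡ m * n + p + e * n + (c - + 2 * e + d) * j
    position = solve-∀
    summand≡term : ∀ j → summand j ≡ term n k j
    summand≡term j = cong₂ (λ L i → sgn j * + L * a ^ j * b ^ j * f ^ (n ∸ 2 ℕ.* j) * S i)
                           (coeff≡lucas n j 1≤n) (position m p c d e (+ n) (+ j))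
    beyond-half : ∀ j → suc (n / 2) ≤ j → term n k j ≡ + 0
    beyond-half j half<j = term-vanish n k j (lucas-vanish-beyond-half n j half<j)
    reposition : ∀ (m p c n : ℤ) → m * n + p + c * n ≡ (m + c) * n + p
    reposition = solve-∀

open import Data.Integer using (+_)
open import Data.Product using (proj₁; proj₂)
open import Data.List.Relation.Unary.All using (lookup)

-- A Padovan-like sequence passing the initial check of t satisfies the shift relation
-- of t everywhere, hence the Lucas expansion.  P and Q pass the check for every tuple.
theorem16 : (t : Tuple6) → t ∈ tuples → (n : ℕ) → n ≥ 1 → (m p : ℤ) →
    (lhs P t n m p ≡ rhs P t n m p) × (lhs Q t n m p ≡ rhs Q t n m p)
theorem16 t@(a , b , c , d , e , f) t∈tuples n n≥1 m p =
  expansion P (seqAt-padovanLike _) (proj₁ initial) , expansion Q (seqAt-padovanLike _) (proj₂ initial)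
  where
  initial : InitialCheck t
  initial = lookup initialChecks t∈tuples
  expansion : ∀ S → IsPadovanLike S → ZeroTriple (defect t S) (+ 0) → lhs S t n m p ≡ rhs S t n m p
  expansion S padovan checked =
    LucasExpansion.identity a b c d e f S (shiftRelation-from-initial t S padovan checked) n n≥1 m p
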